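{- If $\emptyset\vdash M:(v,\mathsf{r})$ is derivable, where $M$ is a finite closed lambda-term of sort $\mathsf{o}$ that is not in beta-normal form, then $\emptyset\vdash N:(v',\mathsf{r})$ is derivable for some lambda-term $N$ with $M\to_\beta N$ (one beta-reduction step) and some $v'\ge v$.
   Context: Sorts are built from the base sort $\mathsf{o}$ by $\to$. Lambda-terms are simply-typed lambda-terms (identified up to alpha-conversion) over the signature with constants $\mathsf{a}:\mathsf{o}\to\mathsf{o}$, $\mathsf{b}:\mathsf{o}\to\mathsf{o}\to\mathsf{o}$, $\mathsf{c}:\mathsf{o}$, $\omega:\mathsf{o}$. Type system: $\mathcal{T}^{\mathsf{o}}=\{\mathsf{r}\}$, $\mathcal{T}^{\alpha\to\beta}=\mathcal{P}(\{\mathsf{pr},\mathsf{np}\}\times\mathcal{T}^\alpha)\times\mathcal{T}^\beta$; an element $(T,\tau)$ is written $\bigwedge T\to\tau$ or $\bigwedge_{i\in I}(f_i,\tau_i)\to\tau$ (pairs distinct); $\top$ is the empty conjunction. A judgment is $\Gamma\vdash M:(v,\tau)$ with $v\in\mathbb{N}$, $\tau$ a type of the sort of $M$, and $\Gamma$ a finite set of bindings $x:(g,\sigma)$ ($g\in\{\mathsf{pr},\mathsf{np}\}$, $\sigma$ a type of the sort of $x$; several bindings for one variable allowed). $\mathit{dom}(\Gamma)$ is the set of variables bound in $\Gamma$; $\Gamma{\restriction}_{\mathsf{pr}}$ is the set of bindings with flag $\mathsf{pr}$; $\mathit{dupl}((\Gamma_i)_{i\in J})=\sum_{i\in J}|\Gamma_i{\restriction}_{\mathsf{pr}}|-|\bigcup_{i\in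 J}\Gamma_i{\restriction}_{\mathsf{pr}}|$. Derivations are finite trees of the rules: $\emptyset\vdash\mathsf{a}:(1,(f,\mathsf{r})\to\mathsf{r})$; $\emptyset\vdash\mathsf{c}:(0,\mathsf{r})$; $\emptyset\vdash\mathsf{b}:(0,(f,\mathsf{r})\to\top\to\mathsf{r})$; $\emptyset\vdash\mathsf{b}:(0,\top\to(f,\mathsf{r})\to\mathsf{r})$ (any $f$); $x:(f,\tau)\vdash x:(0,\tau)$; ($\lambda$): from $\Gamma\cup\{x:(f_i,\tau_i)\mid i\in I\}\vdash K:(v,\tau)$ with $x\notin\mathit{dom}(\Gamma)$ infer $\Gamma\vdash\lambda x.K:(v,\bigwedge_{i\in I}(f_i,\tau_i)\to\tau)$; ($@$): if $0\notin I$, $\Gamma_0\vdash K:(v_0,\bigwedge_{i\in I}(f_i,\tau_i)\to\tau)$ and for each $i\in I$, $\Gamma_i\vdash L:(v_i,\tau_i)$ where $f_i=\mathsf{pr}$ iff ($v_i>0$ or $\Gamma_i{\restriction}_{\mathsf{pr}}\ne\emptyset$), infer $\bigcup_{i\in\{0\}\cup I}\Gamma_i\vdash K\,L:(\mathit{dupl}((\Gamma_i)_{i\in\{0\}\cup I})+\sum_{i\in\{0\}\cup I}v_i,\tau)$. There is no rule for $\omega$. -}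

module Defs where

open import Data.Nat using (ℕ; zero; suc; _+_; _∸_)
open import Data.Bool using (Bool; true; false; _∧_; T)
open import Data.Unit using (⊤; tt)
open import Data.Product using (Σ; _×_; _,_; proj₁; proj₂)
open import Data.List using (List; []; _∷_; map)
open import Data.Nat.ListAction using (sum)
open import Data.List.Relation.Unary.Any using (Any)
open import Data.List.Membership.Propositional using (_∈_)
open import Relation.Binary.PropositionalEquality using (_≡_)
open import Relation.Nullary using (¬_)

infixr 7 _⇒_
data Sort : Set where
  o   : Sort
  _⇒_ : Sort → Sort → Sort

data Flag : Set where
  pr np : Flag

-- Three-valued comparison, used to build a strict total order on types
-- so that finite sets can be represented canonically as strictly
-- increasing lists.

data Ord3 : Set where
  lt eq gt : Ord3

cmpFlag : Flag → Flag → Ord3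
cmpFlag pr pr = eq
cmpFlag pr np = lt
cmpFlag np pr = gt
cmpFlag np np = eq

lex : Ord3 → Ord3 → Ord3
lex lt _ = lt
lex eq y = y
lex gt _ = gt

isLT : Ord3 → Bool
isLT lt = true
isLT eq = false
isLT gt = false

module _ {A : Set} (c : A → A → Ord3) where

  cmpList : List A → List A → Ord3
  cmpList []       []       = eq
  cmpList []       (_ ∷ _)  = lt
  cmpList (_ ∷ _)  []       = gt
  cmpList (x ∷ xs) (y ∷ ys) = lex (c x y) (cmpList xs ys)

  sorted : List A → Bool
  sorted []           = true
  sorted (x ∷ [])     = true
  sorted (x ∷ y ∷ l)  = isLT (c x y) ∧ sorted (y ∷ l)

FSet : (A : Set) → (A → A → Ord3) → Set
FSet A c = Σ (List A) (λ l → T (sorted c l))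

data Base : Set where
  r : Base

mutual
  Ty : Sort → Set
  Ty o       = Base
  Ty (α ⇒ β) = FSet (Flag × Ty α) (cmpB α) × Ty β

  cmpTy : (α : Sort) → Ty α → Ty α → Ord3
  cmpTy o r r = eq
  cmpTy (α ⇒ β) ((l , _) , τ) ((l' , _) , τ') =
    lex (cmpList (cmpB α) l l') (cmpTy β τ τ')

  cmpB : (α : Sort) → Flag × Ty α → Flag × Ty α → Ord3
  cmpB α (f , τ) (g , σ) = lex (cmpFlag f g) (cmpTy α τ σ)

Bind : Sort → Set
Bind σ = Flag × Ty σ

BSet : Sort → Set
BSet σ = FSet (Bind σ) (cmpB σ)

∅ˢ : ∀ {σ} → BSet σ
∅ˢ = [] , tt

⟦_⟧ˢ : ∀ {σ} → Bind σ → BSet σ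
⟦ b ⟧ˢ = (b ∷ []) , tt

-- Lambda-terms (intrinsically sorted, de Bruijn indices = terms up to
-- alpha-conversion), over the signature a, b, c, ω.

infix 4 _∋_
data _∋_ : List Sort → Sort → Set where
  here  : ∀ {Δ σ} → (σ ∷ Δ) ∋ σ
  there : ∀ {Δ σ τ} → Δ ∋ σ → (τ ∷ Δ) ∋ σ

infixl 7 _·_
data Tm (Δ : List Sort) : Sort → Set where
  var  : ∀ {σ} → Δ ∋ σ → Tm Δ σ
  ƛ    : ∀ {σ τ} → Tm (σ ∷ Δ) τ → Tm Δ (σ ⇒ τ)
  _·_  : ∀ {σ τ} → Tm Δ (σ ⇒ τ) → Tm Δ σ → Tm Δ τ
  `a   : Tm Δ (o ⇒ o)
  `b   : Tm Δ (o ⇒ o ⇒ o)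
  `c   : Tm Δ o
  `ω   : Tm Δ o

Ren : List Sort → List Sort → Set
Ren Δ Δ' = ∀ {σ} → Δ ∋ σ → Δ' ∋ σ

ext : ∀ {Δ Δ' τ} → Ren Δ Δ' → Ren (τ ∷ Δ) (τ ∷ Δ')
ext ρ here      = here
ext ρ (there x) = there (ρ x)

rename : ∀ {Δ Δ' σ} → Ren Δ Δ' → Tm Δ σ → Tm Δ' σ
rename ρ (var x) = var (ρ x)
rename ρ (ƛ K)   = ƛ (rename (ext ρ) K)
rename ρ (K · L) = rename ρ K · rename ρ L
rename ρ `a = `a
rename ρ `b = `b
rename ρ `c = `c
rename ρ `ω = `ω

Sub : List Sort → List Sort → Set
Sub Δ Δ' = ∀ {σ} → Δ ∋ σ → Tm Δ' σ

exts : ∀ {Δ Δ' τ} → Sub Δ Δ' → Sub (τ ∷ Δ) (τ ∷ Δ')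
exts s here      = var here
exts s (there x) = rename there (s x)

subst : ∀ {Δ Δ' σ} → Sub Δ Δ' → Tm Δ σ → Tm Δ' σ
subst s (var x) = s x
subst s (ƛ K)   = ƛ (subst (exts s) K)
subst s (K · L) = subst s K · subst s L
subst s `a = `a
subst s `b = `b
subst s `c = `c
subst s `ω = `ω

sub0 : ∀ {Δ σ} → Tm Δ σ → Sub (σ ∷ Δ) Δ
sub0 L here      = L
sub0 L (there x) = var x

_[_] : ∀ {Δ σ τ} → Tm (σ ∷ Δ) τ → Tm Δ σ → Tm Δ τ
K [ L ] = subst (sub0 L) K

infix 4 _→β_
data _→β_ {Δ} : ∀ {τ} → Tm Δ τ → Tm Δ τ → Set where
  β   : ∀ {σ τ} {K : Tm (σ ∷ Δ) τ} {L : Tm Δ σ} → (ƛ K) · L →β K [ L ]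
  ξƛ  : ∀ {σ τ} {K K' : Tm (σ ∷ Δ) τ} → K →β K' → ƛ K →β ƛ K'
  ξ₁  : ∀ {σ τ} {K K' : Tm Δ (σ ⇒ τ)} {L : Tm Δ σ} → K →β K' → K · L →β K' · L
  ξ₂  : ∀ {σ τ} {K : Tm Δ (σ ⇒ τ)} {L L' : Tm Δ σ} → L →β L' → K · L →β K · L'

data HasRedex {Δ} : ∀ {τ} → Tm Δ τ → Set where
  redex : ∀ {σ τ} {K : Tm (σ ∷ Δ) τ} {L : Tm Δ σ} → HasRedex ((ƛ K) · L)
  inƛ   : ∀ {σ τ} {K : Tm (σ ∷ Δ) τ} → HasRedex K → HasRedex (ƛ K)
  inl   : ∀ {σ τ} {K : Tm Δ (σ ⇒ τ)} {L : Tm Δ σ} → HasRedex K → HasRedex (K · L)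
  inr   : ∀ {σ τ} {K : Tm Δ (σ ⇒ τ)} {L : Tm Δ σ} → HasRedex L → HasRedex (K · L)

IsBetaNormal : ∀ {Δ τ} → Tm Δ τ → Set
IsBetaNormal M = ¬ HasRedex M

Ctx : List Sort → Set
Ctx []      = ⊤
Ctx (σ ∷ Δ) = BSet σ × Ctx Δ

at : ∀ {Δ σ} → Ctx Δ → Δ ∋ σ → List (Bind σ)
at (S , Γ) here      = proj₁ S
at (S , Γ) (there x) = at Γ x

emptyCtx : (Δ : List Sort) → Ctx Δ
emptyCtx []      = tt
emptyCtx (σ ∷ Δ) = ∅ˢ , emptyCtx Δ

single : ∀ {Δ σ} → Δ ∋ σ → Bind σ → Ctx Δ
single {_ ∷ Δ} here      b = ⟦ b ⟧ˢ , emptyCtx Δ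
single {_ ∷ Δ} (there x) b = ∅ˢ , single x b

countPr : ∀ {σ} → List (Bind σ) → ℕ
countPr []              = 0
countPr ((pr , _) ∷ l)  = suc (countPr l)
countPr ((np , _) ∷ l)  = countPr l

prSize : ∀ {Δ} → Ctx Δ → ℕ
prSize {[]}    tt      = 0
prSize {σ ∷ Δ} (S , Γ) = countPr (proj₁ S) + prSize Γ

IsUnion : ∀ {Δ} → List (Ctx Δ) → Ctx Δ → Set
IsUnion {Δ} Gs Γ = ∀ {σ} (x : Δ ∋ σ) (b : Bind σ) →
  (b ∈ at Γ x → Any (λ G → b ∈ at G x) Gs) × (Any (λ G → b ∈ at G x) Gs → b ∈ at Γ x)

dupl : ∀ {Δ} → List (Ctx Δ) → Ctx Δ → ℕ
dupl Gs Γ = sum (map prSize Gs) ∸ prSize Γ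

-- the flag forced by (v, Γ): pr iff v > 0 or Γ↾pr ≠ ∅
flagOf : ℕ → ℕ → Flag
flagOf zero zero = np
flagOf zero (suc _) = pr
flagOf (suc _) _ = pr

mutual
  data Der {Δ} : ∀ {α} → Ctx Δ → Tm Δ α → ℕ → Ty α → Set where
    da   : ∀ f → Der (emptyCtx Δ) `a 1 (⟦ f , r ⟧ˢ , r)
    dc   : Der (emptyCtx Δ) `c 0 r
    db₁  : ∀ f → Der (emptyCtx Δ) `b 0 (⟦ f , r ⟧ˢ , (∅ˢ , r))
    db₂  : ∀ f → Der (emptyCtx Δ) `b 0 (∅ˢ , (⟦ f , r ⟧ˢ , r))
    dvar : ∀ {σ} (x : Δ ∋ σ) (f : Flag) (τ : Ty σ) → Der (single x (f , τ)) (var x) 0 τ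
    dlam : ∀ {σ α} {Γ : Ctx Δ} {S : BSet σ} {K : Tm (σ ∷ Δ) α} {v τ} →
           Der {σ ∷ Δ} (S , Γ) K v τ → Der Γ (ƛ K) v (S , τ)
    dapp : ∀ {σ α} {Γ₀ Γ : Ctx Δ} {Gs : List (Ctx Δ)} {K : Tm Δ (σ ⇒ α)} {L : Tm Δ σ}
             {S : BSet σ} {τ : Ty α} {v₀ vs : ℕ} →
           Der Γ₀ K v₀ (S , τ) →
           Args Gs L (proj₁ S) vs →
           IsUnion (Γ₀ ∷ Gs) Γ →
           Der Γ (K · L) (dupl (Γ₀ ∷ Gs) Γ + (v₀ + vs)) τ

  data Args {Δ σ} : List (Ctx Δ) → Tm Δ σ → List (Bind σ) → ℕ → Set where
    []  : ∀ {L} → Args [] L [] 0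
    _∷_ : ∀ {Γi Gs L vi vs f τi T} →
          Der Γi L vi τi × f ≡ flagOf vi (prSize Γi) →
          Args Gs L T vs →
          Args (Γi ∷ Gs) L ((f , τi) ∷ T) (vi + vs)

-- A closed term is β-normal only if it is headed by a or b, so a closed term of sort o that is
-- not normal has a redex at its head, inside the function part of an application, or inside an
-- argument of a or b. Such an argument has at most one premise, of sort o: if it has one, the step
-- is taken there by induction, otherwise anywhere in the argument, which the derivation ignores.
-- Contracting a head redex (λx.K) L does not lower the value: substituting L for x replaces every
-- binding x : (f, τ) in the derivation of K by the premise for L at τ, whose value W (f, τ) is
-- added. Where an application merges bindings of x from several premises into their union, dupl
-- loses one for each merged pr-binding, but the values of the premises still count that binding's
-- weight once per premise, and a pr-binding has weight at least 1 because a premise of the closed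
-- term L is flagged pr exactly when its value is positive.
module Submission where

open import Defs
open import Algebra.Properties.CommutativeSemigroup using (interchange)
open import Data.Bool using (T)
open import Data.Bool.Properties using (T-irrelevant)
open import Data.Empty using (⊥-elim)
open import Data.List using (List; []; _∷_; _++_; map; concatMap)
open import Data.List.Properties using (map-∘; map-cong; map-cong-local; map-++)
open import Data.List.Membership.Propositional using (_∈_)
open import Data.List.Membership.Propositional.Properties
  using (∈-∃++; ∈-++⁻; ∈-++⁺ˡ; ∈-++⁺ʳ; ∈-concat⁺; ∈-concat⁻)
open import Data.List.Relation.Binary.Permutation.Propositional using (↭-sym)
open import Data.List.Relation.Binary.Permutation.Propositional.Properties using (map⁺; shift)
open import Data.List.Relation.Binary.Subset.Propositional using (_⊆_)
open import Data.List.Relation.Unary.All as All using (All; []; _∷_)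
import Data.List.Relation.Unary.All.Properties as All
open import Data.List.Relation.Unary.AllPairs as AllPairs using ([]; _∷_)
open import Data.List.Relation.Unary.Any using (here; there)
import Data.List.Relation.Unary.Any as Any
import Data.List.Relation.Unary.Any.Properties as Any
open import Data.List.Relation.Unary.Unique.Propositional using (Unique)
open import Data.Nat using (ℕ; zero; suc; _+_; _∸_; _≤_; z≤n; s≤s)
open import Data.Nat.ListAction using (sum)
open import Data.Nat.ListAction.Properties using (sum-↭; sum-++)
open import Data.Nat.Properties hiding (_≟_)
open import Data.Nat.Tactic.RingSolver using (solve-∀)
open import Data.Product using (Σ; _×_; _,_; proj₁; proj₂)
open import Data.Sum using (_⊎_; inj₁; inj₂)
open import Data.Unit using (tt)
open import Function using (_∘_)
open import Relation.Binary.Definitions using (DecidableEquality)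
open import Relation.Binary.PropositionalEquality hiding (subst; [_])
import Relation.Binary.PropositionalEquality as ≡
open import Relation.Nullary using (¬_; yes; no; Dec)
open import Relation.Nullary.Decidable using (decidable-stable)

+-interchange : ∀ a b c d → (a + b) + (c + d) ≡ (a + c) + (b + d)
+-interchange = interchange +-commutativeSemigroup

sum-map-⊆ : {A : Set} (g : A → ℕ) {xs ys : List A} → Unique xs → xs ⊆ ys → sum (map g xs) ≤ sum (map g ys)
sum-map-⊆ g {[]}     _            _      = z≤n
sum-map-⊆ g {x ∷ xs} (x∉xs ∷ uxs) xxs⊆ys
  with ys₁ , ys₂ , refl ← ∈-∃++ (xxs⊆ys (here refl)) = begin
    g x + sum (map g xs)              ≤⟨ +-monoʳ-≤ (g x) (sum-map-⊆ g uxs xs⊆ys₁ys₂) ⟩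
    g x + sum (map g (ys₁ ++ ys₂))    ≡⟨ sum-↭ (↭-sym (map⁺ g (shift x ys₁ ys₂))) ⟩
    sum (map g (ys₁ ++ x ∷ ys₂))      ∎
  where
  open ≤-Reasoning
  xs⊆ys₁ys₂ : xs ⊆ ys₁ ++ ys₂
  xs⊆ys₁ys₂ y∈xs with ∈-++⁻ ys₁ (xxs⊆ys (there y∈xs))
  ... | inj₁ y∈ys₁         = ∈-++⁺ˡ y∈ys₁
  ... | inj₂ (here refl)   = ⊥-elim (All.lookup x∉xs y∈xs refl)
  ... | inj₂ (there y∈ys₂) = ∈-++⁺ʳ ys₁ y∈ys₂

sum-map-+ : {A : Set} (f g : A → ℕ) (l : List A) →
            sum (map (λ x → f x + g x) l) ≡ sum (map f l) + sum (map g l)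
sum-map-+ f g []      = refl
sum-map-+ f g (x ∷ l) rewrite sum-map-+ f g l = +-interchange (f x) (g x) _ _

record IsStrictCmp {A : Set} (c : A → A → Ord3) : Set where
  field
    eq⇒≡     : ∀ {x y} → c x y ≡ eq → x ≡ y
    refl-eq  : ∀ x → c x x ≡ eq
    lt-trans : ∀ {x y z} → c x y ≡ lt → c y z ≡ lt → c x z ≡ lt

  lt⇒≢ : ∀ {x y} → c x y ≡ lt → x ≢ y
  lt⇒≢ {x} x<x refl with () ← trans (sym (refl-eq x)) x<x

  gt⇒≢ : ∀ {x y} → c x y ≡ gt → x ≢ y
  gt⇒≢ {x} x>x refl with () ← trans (sym (refl-eq x)) x>x

  _≟_ : DecidableEquality A
  x ≟ y with c x y in e
  ... | eq = yes (eq⇒≡ e)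
  ... | lt = no (lt⇒≢ e)
  ... | gt = no (gt⇒≢ e)

  sorted⇒Unique : ∀ l → T (sorted c l) → Unique l
  sorted⇒Unique l s = AllPairs.map lt⇒≢ (sorted⇒lt l s)
    where
    uncons : ∀ x y l → T (sorted c (x ∷ y ∷ l)) → c x y ≡ lt × T (sorted c (y ∷ l))
    uncons x y l s with c x y
    ... | lt = refl , s

    sorted⇒lt : ∀ l → T (sorted c l) → AllPairs.AllPairs (λ x y → c x y ≡ lt) l
    sorted⇒lt []           _ = []
    sorted⇒lt (x ∷ [])     _ = [] ∷ []
    sorted⇒lt (x ∷ y ∷ l) s =
      let x<y , s' = uncons x y l s
          ps = sorted⇒lt (y ∷ l) s'
      in (x<y ∷ All.map (lt-trans x<y) (AllPairs.head ps)) ∷ ps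

open IsStrictCmp

module _ {A : Set} {c : A → A → Ord3} (C : IsStrictCmp c) where

  lex-eq⇒ : ∀ {a a' o} → lex (c a a') o ≡ eq → a ≡ a' × o ≡ eq
  lex-eq⇒ {a} {a'} e with c a a' in e₁
  ... | eq = eq⇒≡ C e₁ , e

  lex-lt-trans : ∀ {a₁ a₂ a₃ o₁₂ o₂₃ o₁₃} → (o₁₂ ≡ lt → o₂₃ ≡ lt → o₁₃ ≡ lt) →
                 lex (c a₁ a₂) o₁₂ ≡ lt → lex (c a₂ a₃) o₂₃ ≡ lt → lex (c a₁ a₃) o₁₃ ≡ lt
  lex-lt-trans {a₁} {a₂} {a₃} o-trans e e' with c a₁ a₂ in e₁₂ | c a₂ a₃ in e₂₃
  ... | lt | lt rewrite lt-trans C e₁₂ e₂₃ = refl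
  ... | lt | eq rewrite eq⇒≡ C e₂₃ | e₁₂ = refl
  ... | eq | lt rewrite eq⇒≡ C e₁₂ | e₂₃ = refl
  ... | eq | eq rewrite eq⇒≡ C e₁₂ | eq⇒≡ C e₂₃ | refl-eq C a₃ = o-trans e e'

  cmpList-eq⇒≡ : ∀ {xs ys} → cmpList c xs ys ≡ eq → xs ≡ ys
  cmpList-eq⇒≡ {[]}     {[]}     _ = refl
  cmpList-eq⇒≡ {x ∷ xs} {y ∷ ys} e =
    let x≡y , o≡eq = lex-eq⇒ e in cong₂ _∷_ x≡y (cmpList-eq⇒≡ o≡eq)

  cmpList-refl : ∀ xs → cmpList c xs xs ≡ eq
  cmpList-refl []       = refl
  cmpList-refl (x ∷ xs) rewrite refl-eq C x = cmpList-refl xs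

  cmpList-lt-trans : ∀ {xs ys zs} → cmpList c xs ys ≡ lt → cmpList c ys zs ≡ lt → cmpList c xs zs ≡ lt
  cmpList-lt-trans {[]}     {_ ∷ _}  {_ ∷ _}  _ _ = refl
  cmpList-lt-trans {_ ∷ xs} {_ ∷ ys} {_ ∷ zs} e e' = lex-lt-trans (cmpList-lt-trans {xs} {ys} {zs}) e e'
  cmpList-lt-trans {[]}     {[]}     ()
  cmpList-lt-trans {_}      {_ ∷ _}  {[]}     _ ()
  cmpList-lt-trans {_ ∷ _}  {[]}     ()

  cmpFSet-isStrictCmp : IsStrictCmp {FSet A c} (λ s s' → cmpList c (proj₁ s) (proj₁ s'))
  cmpFSet-isStrictCmp = record
    { eq⇒≡     = λ {(xs , p)} {(ys , q)} e → fset-≡ (cmpList-eq⇒≡ e) p q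
    ; refl-eq  = λ s → cmpList-refl (proj₁ s)
    ; lt-trans = λ {s₁ s₂ s₃} → cmpList-lt-trans {proj₁ s₁} {proj₁ s₂} {proj₁ s₃}
    }
    where
    fset-≡ : ∀ {xs ys} → xs ≡ ys → (p : T (sorted c xs)) (q : T (sorted c ys)) → (xs , p) ≡ (ys , q)
    fset-≡ refl p q = cong (_ ,_) (T-irrelevant p q)

lexCmp : {A B : Set} → (A → A → Ord3) → (B → B → Ord3) → A × B → A × B → Ord3
lexCmp c d (a , b) (a' , b') = lex (c a a') (d b b')

lex-isStrictCmp : {A B : Set} {c : A → A → Ord3} {d : B → B → Ord3} →
                  IsStrictCmp c → IsStrictCmp d → IsStrictCmp (lexCmp c d)
lex-isStrictCmp C D = record
  { eq⇒≡     = λ e → let a≡a' , o≡eq = lex-eq⇒ C e in cong₂ _,_ a≡a' (eq⇒≡ D o≡eq)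
  ; refl-eq  = λ { (a , b) → trans (cong (λ o → lex o _) (refl-eq C a)) (refl-eq D b) }
  ; lt-trans = lex-lt-trans C (lt-trans D)
  }

cmpFlag-isStrictCmp : IsStrictCmp cmpFlag
cmpFlag-isStrictCmp = record { eq⇒≡ = eq⇒≡′ ; refl-eq = refl-eq′ ; lt-trans = lt-trans′ }
  where
  eq⇒≡′ : ∀ {f g} → cmpFlag f g ≡ eq → f ≡ g
  eq⇒≡′ {pr} {pr} _ = refl
  eq⇒≡′ {np} {np} _ = refl

  refl-eq′ : ∀ f → cmpFlag f f ≡ eq
  refl-eq′ pr = refl
  refl-eq′ np = refl

  lt-trans′ : ∀ {f g h} → cmpFlag f g ≡ lt → cmpFlag g h ≡ lt → cmpFlag f h ≡ lt
  lt-trans′ {pr} {np} {pr} _ ()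
  lt-trans′ {pr} {np} {np} _ ()
  lt-trans′ {pr} {pr} ()
  lt-trans′ {np} {pr} ()
  lt-trans′ {np} {np} ()

mutual
  cmpTy-isStrictCmp : ∀ α → IsStrictCmp (cmpTy α)
  cmpTy-isStrictCmp o       = record
    { eq⇒≡ = λ { {r} {r} _ → refl } ; refl-eq = λ { r → refl } ; lt-trans = λ { {r} {r} () } }
  cmpTy-isStrictCmp (α ⇒ ρ) = lex-isStrictCmp (cmpFSet-isStrictCmp (cmpB-isStrictCmp α)) (cmpTy-isStrictCmp ρ)

  cmpB-isStrictCmp : ∀ α → IsStrictCmp (cmpB α)
  cmpB-isStrictCmp α = lex-isStrictCmp cmpFlag-isStrictCmp (cmpTy-isStrictCmp α)

_≟ᴮ_ : ∀ {σ} → DecidableEquality (Bind σ)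
_≟ᴮ_ {σ} = _≟_ (cmpB-isStrictCmp σ)

punchIn : ∀ Ξ {Θ ρ τ} → (Ξ ++ Θ) ∋ τ → (Ξ ++ ρ ∷ Θ) ∋ τ
punchIn []      x         = there x
punchIn (_ ∷ Ξ) here      = here
punchIn (_ ∷ Ξ) (there x) = there (punchIn Ξ x)

pivot : ∀ Ξ {Θ ρ} → (Ξ ++ ρ ∷ Θ) ∋ ρ
pivot []      = here
pivot (_ ∷ Ξ) = there (pivot Ξ)

data PivotView (Ξ : List Sort) {Θ ρ} : ∀ {τ} → (Ξ ++ ρ ∷ Θ) ∋ τ → Set where
  punched : ∀ {τ} (x : (Ξ ++ Θ) ∋ τ) → PivotView Ξ (punchIn Ξ x)
  at-pivot : PivotView Ξ (pivot Ξ)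

pivotView : ∀ Ξ {Θ ρ τ} (y : (Ξ ++ ρ ∷ Θ) ∋ τ) → PivotView Ξ y
pivotView []      here      = at-pivot
pivotView []      (there x) = punched x
pivotView (_ ∷ Ξ) here      = punched here
pivotView (_ ∷ Ξ) (there y) with pivotView Ξ y
... | punched x = punched (there x)
... | at-pivot  = at-pivot

insertCtx : ∀ Ξ {Θ ρ} → Ctx (Ξ ++ Θ) → Ctx (Ξ ++ ρ ∷ Θ)
insertCtx []      Γ       = ∅ˢ , Γ
insertCtx (_ ∷ Ξ) (S , Γ) = S , insertCtx Ξ Γ

removeCtx : ∀ Ξ {Θ ρ} → Ctx (Ξ ++ ρ ∷ Θ) → Ctx (Ξ ++ Θ)
removeCtx []      (_ , Γ) = Γ
removeCtx (_ ∷ Ξ) (S , Γ) = S , removeCtx Ξ Γ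

at-emptyCtx : ∀ {Δ σ} (x : Δ ∋ σ) → at (emptyCtx Δ) x ≡ []
at-emptyCtx here      = refl
at-emptyCtx (there x) = at-emptyCtx x

at-single : ∀ {Δ σ} (x : Δ ∋ σ) b → at (single x b) x ≡ b ∷ []
at-single here      b = refl
at-single (there x) b = at-single x b

at-insertCtx-punchIn : ∀ Ξ {Θ ρ τ} (Γ : Ctx (Ξ ++ Θ)) (x : (Ξ ++ Θ) ∋ τ) →
                       at (insertCtx Ξ {Θ} {ρ} Γ) (punchIn Ξ x) ≡ at Γ x
at-insertCtx-punchIn []      Γ       x         = refl
at-insertCtx-punchIn (_ ∷ Ξ) (S , Γ) here      = refl
at-insertCtx-punchIn (_ ∷ Ξ) (S , Γ) (there x) = at-insertCtx-punchIn Ξ Γ x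

at-insertCtx-pivot : ∀ Ξ {Θ ρ} (Γ : Ctx (Ξ ++ Θ)) → at (insertCtx Ξ {Θ} {ρ} Γ) (pivot Ξ) ≡ []
at-insertCtx-pivot []      Γ       = refl
at-insertCtx-pivot (_ ∷ Ξ) (S , Γ) = at-insertCtx-pivot Ξ Γ

prSize-insertCtx : ∀ Ξ {Θ ρ} (Γ : Ctx (Ξ ++ Θ)) → prSize (insertCtx Ξ {Θ} {ρ} Γ) ≡ prSize Γ
prSize-insertCtx []      Γ       = refl
prSize-insertCtx (_ ∷ Ξ) (S , Γ) = cong (countPr (proj₁ S) +_) (prSize-insertCtx Ξ Γ)

insertCtx-emptyCtx : ∀ Ξ {Θ ρ} → insertCtx Ξ {Θ} {ρ} (emptyCtx (Ξ ++ Θ)) ≡ emptyCtx (Ξ ++ ρ ∷ Θ)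
insertCtx-emptyCtx []      = refl
insertCtx-emptyCtx (_ ∷ Ξ) = cong (∅ˢ ,_) (insertCtx-emptyCtx Ξ)

insertCtx-single : ∀ Ξ {Θ ρ σ} (x : (Ξ ++ Θ) ∋ σ) b →
                   insertCtx Ξ {Θ} {ρ} (single x b) ≡ single (punchIn Ξ x) b
insertCtx-single []      x         b = refl
insertCtx-single (_ ∷ Ξ) here      b = cong (⟦ b ⟧ˢ ,_) (insertCtx-emptyCtx Ξ)
insertCtx-single (_ ∷ Ξ) (there x) b = cong (∅ˢ ,_) (insertCtx-single Ξ x b)

at-removeCtx : ∀ Ξ {Θ ρ τ} (Γ : Ctx (Ξ ++ ρ ∷ Θ)) (x : (Ξ ++ Θ) ∋ τ) →
               at (removeCtx Ξ Γ) x ≡ at Γ (punchIn Ξ x)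
at-removeCtx []      (_ , Γ) x         = refl
at-removeCtx (_ ∷ Ξ) (S , Γ) here      = refl
at-removeCtx (_ ∷ Ξ) (S , Γ) (there x) = at-removeCtx Ξ Γ x

prSize-removeCtx : ∀ Ξ {Θ ρ} (Γ : Ctx (Ξ ++ ρ ∷ Θ)) →
                   prSize Γ ≡ prSize (removeCtx Ξ Γ) + countPr (at Γ (pivot Ξ))
prSize-removeCtx []      (S , Γ) = +-comm (countPr (proj₁ S)) (prSize Γ)
prSize-removeCtx (_ ∷ Ξ) (S , Γ) rewrite prSize-removeCtx Ξ Γ =
  sym (+-assoc (countPr (proj₁ S)) _ _)

removeCtx-emptyCtx : ∀ Ξ {Θ ρ} → removeCtx Ξ (emptyCtx (Ξ ++ ρ ∷ Θ)) ≡ emptyCtx (Ξ ++ Θ)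
removeCtx-emptyCtx []      = refl
removeCtx-emptyCtx (_ ∷ Ξ) = cong (∅ˢ ,_) (removeCtx-emptyCtx Ξ)

removeCtx-single-punchIn : ∀ Ξ {Θ ρ σ} (x : (Ξ ++ Θ) ∋ σ) b →
                           removeCtx Ξ (single (punchIn Ξ {Θ} {ρ} x) b) ≡ single x b
removeCtx-single-punchIn []      x         b = refl
removeCtx-single-punchIn (_ ∷ Ξ) here      b = cong (⟦ b ⟧ˢ ,_) (removeCtx-emptyCtx Ξ)
removeCtx-single-punchIn (_ ∷ Ξ) (there x) b = cong (∅ˢ ,_) (removeCtx-single-punchIn Ξ x b)

removeCtx-single-pivot : ∀ Ξ {Θ ρ} b → removeCtx Ξ (single (pivot Ξ {Θ} {ρ}) b) ≡ emptyCtx (Ξ ++ Θ)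
removeCtx-single-pivot []      b = refl
removeCtx-single-pivot (_ ∷ Ξ) b = cong (∅ˢ ,_) (removeCtx-single-pivot Ξ b)

at-single-punchIn-pivot : ∀ Ξ {Θ ρ σ} (x : (Ξ ++ Θ) ∋ σ) b →
                          at (single (punchIn Ξ {Θ} {ρ} x) b) (pivot Ξ) ≡ []
at-single-punchIn-pivot []      x         b = refl
at-single-punchIn-pivot (_ ∷ Ξ) here      b = at-emptyCtx (pivot Ξ)
at-single-punchIn-pivot (_ ∷ Ξ) (there x) b = at-single-punchIn-pivot Ξ x b

Reindexing : ∀ {Δ Δ'} → (Ctx Δ → Ctx Δ') → Set
Reindexing {Δ} {Δ'} F = ∀ {σ} (y : Δ' ∋ σ) →
  (∀ G → at (F G) y ≡ []) ⊎ Σ (Δ ∋ σ) (λ x → ∀ G → at (F G) y ≡ at G x)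

IsUnion-map : ∀ {Δ Δ'} {F : Ctx Δ → Ctx Δ'} → Reindexing F →
              ∀ {Gs Γ} → IsUnion Gs Γ → IsUnion (map F Gs) (F Γ)
IsUnion-map {F = F} reindex {Gs} {Γ} u y b with reindex y
... | inj₁ empty =
        (λ b∈ → ⊥-elim (Any.¬Any[] (≡.subst (b ∈_) (empty Γ) b∈)))
      , (λ any → let G , b∈ = Any.satisfied (Any.map⁻ any) in
                 ⊥-elim (Any.¬Any[] (≡.subst (b ∈_) (empty G) b∈)))
... | inj₂ (x , at-x) =
        (λ b∈ → Any.map⁺ (Any.map (λ {G} → ≡.subst (b ∈_) (sym (at-x G)))
                  (proj₁ (u x b) (≡.subst (b ∈_) (at-x Γ) b∈))))
      , (λ any → ≡.subst (b ∈_) (sym (at-x Γ))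
                  (proj₂ (u x b) (Any.map (λ {G} → ≡.subst (b ∈_) (at-x G)) (Any.map⁻ any))))

insertCtx-reindexing : ∀ Ξ {Θ ρ} → Reindexing (insertCtx Ξ {Θ} {ρ})
insertCtx-reindexing Ξ y with pivotView Ξ y
... | punched x = inj₂ (x , λ G → at-insertCtx-punchIn Ξ G x)
... | at-pivot  = inj₁ (at-insertCtx-pivot Ξ)

removeCtx-reindexing : ∀ Ξ {Θ ρ} → Reindexing (removeCtx Ξ {Θ} {ρ})
removeCtx-reindexing Ξ x = inj₂ (punchIn Ξ x , λ G → at-removeCtx Ξ G x)

sum-map-prSize-insertCtx : ∀ Ξ {Θ ρ} (Gs : List (Ctx (Ξ ++ Θ))) →
                           sum (map prSize (map (insertCtx Ξ {Θ} {ρ}) Gs)) ≡ sum (map prSize Gs)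
sum-map-prSize-insertCtx Ξ Gs = cong sum (trans (sym (map-∘ Gs)) (map-cong (prSize-insertCtx Ξ) Gs))

dupl-insertCtx : ∀ Ξ {Θ ρ} (Gs : List (Ctx (Ξ ++ Θ))) Γ →
                 dupl (map (insertCtx Ξ {Θ} {ρ}) Gs) (insertCtx Ξ Γ) ≡ dupl Gs Γ
dupl-insertCtx Ξ Gs Γ = cong₂ _∸_ (sum-map-prSize-insertCtx Ξ Gs) (prSize-insertCtx Ξ Γ)

PunchesIn : ∀ Ξ {Θ ρ} → Ren (Ξ ++ Θ) (Ξ ++ ρ ∷ Θ) → Set
PunchesIn Ξ {Θ} ren = ∀ {τ} (x : (Ξ ++ Θ) ∋ τ) → ren x ≡ punchIn Ξ x

Der-insertCtx-emptyCtx : ∀ Ξ {Θ ρ α} {K : Tm (Ξ ++ ρ ∷ Θ) α} {v τ} →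
                         Der (emptyCtx _) K v τ → Der (insertCtx Ξ {Θ} {ρ} (emptyCtx _)) K v τ
Der-insertCtx-emptyCtx Ξ {K = K} {v} {τ} = ≡.subst (λ Γ → Der Γ K v τ) (sym (insertCtx-emptyCtx Ξ))

mutual
  weaken : ∀ Ξ {Θ ρ} {ren : Ren (Ξ ++ Θ) (Ξ ++ ρ ∷ Θ)} → PunchesIn Ξ ren →
           ∀ {α} {Γ : Ctx (Ξ ++ Θ)} {M : Tm (Ξ ++ Θ) α} {v τ} →
           Der Γ M v τ → Der (insertCtx Ξ {Θ} {ρ} Γ) (rename ren M) v τ
  weaken Ξ ren≗ (da f)  = Der-insertCtx-emptyCtx Ξ (da f)
  weaken Ξ ren≗ dc      = Der-insertCtx-emptyCtx Ξ dc
  weaken Ξ ren≗ (db₁ f) = Der-insertCtx-emptyCtx Ξ (db₁ f)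
  weaken Ξ ren≗ (db₂ f) = Der-insertCtx-emptyCtx Ξ (db₂ f)
  weaken Ξ ren≗ (dvar x f τ) =
    ≡.subst₂ (λ Γ y → Der Γ (var y) 0 τ) (sym (insertCtx-single Ξ x (f , τ))) (sym (ren≗ x))
      (dvar (punchIn Ξ x) f τ)
  weaken Ξ {ren = ren} ren≗ (dlam {σ = σ} D) = dlam (weaken (σ ∷ Ξ) ext-ren≗ D)
    where
    ext-ren≗ : PunchesIn (σ ∷ Ξ) (ext ren)
    ext-ren≗ here      = refl
    ext-ren≗ (there x) = cong there (ren≗ x)
  weaken Ξ {Θ} {ρ} ren≗ (dapp {Γ₀ = Γ₀} {Γ} {Gs} D args u)
    rewrite sym (dupl-insertCtx Ξ {Θ} {ρ} (Γ₀ ∷ Gs) Γ) =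
    dapp (weaken Ξ ren≗ D) (weaken-Args Ξ ren≗ args) (IsUnion-map (insertCtx-reindexing Ξ) u)

  weaken-Args : ∀ Ξ {Θ ρ} {ren : Ren (Ξ ++ Θ) (Ξ ++ ρ ∷ Θ)} → PunchesIn Ξ ren →
                ∀ {σ Gs} {L : Tm (Ξ ++ Θ) σ} {T vs} →
                Args Gs L T vs → Args (map (insertCtx Ξ {Θ} {ρ}) Gs) (rename ren L) T vs
  weaken-Args Ξ ren≗ [] = []
  weaken-Args Ξ ren≗ (_∷_ {Γi = Γi} {vi = vi} (D , f≡) args) =
    (weaken Ξ ren≗ D , trans f≡ (cong (flagOf vi) (sym (prSize-insertCtx Ξ Γi)))) ∷ weaken-Args Ξ ren≗ args

at-sorted : ∀ {Δ σ} (Γ : Ctx Δ) (x : Δ ∋ σ) → T (sorted (cmpB σ) (at Γ x))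
at-sorted (S , Γ) here      = proj₂ S
at-sorted (S , Γ) (there x) = at-sorted Γ x

at-Unique : ∀ {Δ σ} (Γ : Ctx Δ) (x : Δ ∋ σ) → Unique (at Γ x)
at-Unique {σ = σ} Γ x = sorted⇒Unique (cmpB-isStrictCmp σ) (at Γ x) (at-sorted Γ x)

bindingsAt : ∀ {Δ σ} → Δ ∋ σ → List (Ctx Δ) → List (Bind σ)
bindingsAt x = concatMap (λ G → at G x)

module _ {Δ} {Gs : List (Ctx Δ)} {Γ : Ctx Δ} (u : IsUnion Gs Γ) {σ} (x : Δ ∋ σ) where

  at-union⊆bindingsAt : at Γ x ⊆ bindingsAt x Gs
  at-union⊆bindingsAt {b} b∈ = ∈-concat⁺ (Any.map⁺ (proj₁ (u x b) b∈))

  bindingsAt⊆at-union : bindingsAt x Gs ⊆ at Γ x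
  bindingsAt⊆at-union {b} b∈ = proj₂ (u x b) (Any.map⁻ (∈-concat⁻ (map (λ G → at G x) Gs) b∈))

isPr : ∀ {σ} → Bind σ → ℕ
isPr (pr , _) = 1
isPr (np , _) = 0

NoPr : ∀ {σ} → List (Bind σ) → Set
NoPr = All (λ b → proj₁ b ≡ np)

countPr≡sum-isPr : ∀ {σ} (l : List (Bind σ)) → countPr l ≡ sum (map isPr l)
countPr≡sum-isPr []             = refl
countPr≡sum-isPr ((pr , _) ∷ l) = cong suc (countPr≡sum-isPr l)
countPr≡sum-isPr ((np , _) ∷ l) = countPr≡sum-isPr l

countPr-++ : ∀ {σ} (l m : List (Bind σ)) → countPr (l ++ m) ≡ countPr l + countPr m
countPr-++ l m = begin
  countPr (l ++ m)                       ≡⟨ countPr≡sum-isPr (l ++ m) ⟩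
  sum (map isPr (l ++ m))                ≡⟨ cong sum (map-++ isPr l m) ⟩
  sum (map isPr l ++ map isPr m)         ≡⟨ sum-++ (map isPr l) (map isPr m) ⟩
  sum (map isPr l) + sum (map isPr m)    ≡⟨ sym (cong₂ _+_ (countPr≡sum-isPr l) (countPr≡sum-isPr m)) ⟩
  countPr l + countPr m                  ∎
  where open ≡-Reasoning

countPr-mono-⊆ : ∀ {σ} {l m : List (Bind σ)} → Unique l → l ⊆ m → countPr l ≤ countPr m
countPr-mono-⊆ {l = l} {m} ul l⊆m
  rewrite countPr≡sum-isPr l | countPr≡sum-isPr m = sum-map-⊆ isPr ul l⊆m

NoPr⇒countPr≡0 : ∀ {σ} {l : List (Bind σ)} → NoPr l → countPr l ≡ 0
NoPr⇒countPr≡0 []           = refl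
NoPr⇒countPr≡0 (refl ∷ nps) = NoPr⇒countPr≡0 nps

countPr≡0⇒NoPr : ∀ {σ} (l : List (Bind σ)) → countPr l ≡ 0 → NoPr l
countPr≡0⇒NoPr []             _ = []
countPr≡0⇒NoPr ((np , _) ∷ l) e = refl ∷ countPr≡0⇒NoPr l e

sum-prSize-removeCtx : ∀ Ξ {Θ ρ} (Gs : List (Ctx (Ξ ++ ρ ∷ Θ))) →
  sum (map prSize Gs) ≡ sum (map prSize (map (removeCtx Ξ) Gs)) + countPr (bindingsAt (pivot Ξ) Gs)
sum-prSize-removeCtx Ξ []       = refl
sum-prSize-removeCtx Ξ (G ∷ Gs) = begin
  prSize G + sum (map prSize Gs)  ≡⟨ cong₂ _+_ (prSize-removeCtx Ξ G) (sum-prSize-removeCtx Ξ Gs) ⟩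
  (g + p) + (gs + ps)             ≡⟨ +-interchange g p gs ps ⟩
  (g + gs) + (p + ps)             ≡⟨ cong ((g + gs) +_) (sym (countPr-++ (at G (pivot Ξ)) _)) ⟩
  (g + gs) + countPr (bindingsAt (pivot Ξ) (G ∷ Gs)) ∎
  where
  open ≡-Reasoning
  g gs p ps : ℕ
  g  = prSize (removeCtx Ξ G)
  gs = sum (map prSize (map (removeCtx Ξ) Gs))
  p  = countPr (at G (pivot Ξ))
  ps = countPr (bindingsAt (pivot Ξ) Gs)

flagOf-suc : ∀ v n → flagOf v (suc n) ≡ pr
flagOf-suc zero    n = refl
flagOf-suc (suc v) n = refl

flagOf≡np⇒≡0 : ∀ v → np ≡ flagOf v 0 → v ≡ 0
flagOf≡np⇒≡0 zero _ = refl

flagOf≡pr⇒>0 : ∀ v → pr ≡ flagOf v 0 → 1 ≤ v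
flagOf≡pr⇒>0 (suc v) _ = s≤s z≤n

-- A premise keeps its flag when p of its pr-bindings are traded for a value increase of at least p.
flagOf-trade : ∀ n {p q v v'} → p ≤ q → v + q ≤ v' → (p ≡ 0 → v' ≡ v) → flagOf v' n ≡ flagOf v (n + p)
flagOf-trade n {zero}  _ _ unchanged rewrite unchanged refl | +-identityʳ n = refl
flagOf-trade n {suc p} {suc q} {v} {suc v'} _ _ _ rewrite +-suc n p = sym (flagOf-suc v (n + p))
flagOf-trade n {suc p} {suc q} {v} {zero}   _ v+q≤0 _ with () ← ≤-trans (m≤n+m (suc q) v) v+q≤0

monus-trade : ∀ A B {X P} → P ≤ X → (A + X) ∸ (B + P) + P ≤ (A ∸ B) + X
monus-trade A B {X} {P} P≤X = begin
  (A + X) ∸ (B + P) + P      ≤⟨ +-monoˡ-≤ P (m≤n+o⇒m∸n≤o (A + X) (B + P) A+X≤) ⟩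
  (A ∸ B) + (X ∸ P) + P      ≡⟨ +-assoc (A ∸ B) (X ∸ P) P ⟩
  (A ∸ B) + (X ∸ P + P)      ≡⟨ cong ((A ∸ B) +_) (m∸n+n≡m P≤X) ⟩
  (A ∸ B) + X                ∎
  where
  open ≤-Reasoning
  A+X≤ : A + X ≤ (B + P) + ((A ∸ B) + (X ∸ P))
  A+X≤ = begin
    A + X                               ≤⟨ +-mono-≤ (m≤n+m∸n A B) (m≤n+m∸n X P) ⟩
    (B + (A ∸ B)) + (P + (X ∸ P))       ≡⟨ +-interchange B (A ∸ B) P (X ∸ P) ⟩
    (B + P) + ((A ∸ B) + (X ∸ P))       ∎

-- Read with A and B the pr-sizes of the premises and of their union once x is removed, X and P the
-- numbers of pr-bindings of x in the premises and in the union, E and E' the weights in excess of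
-- isPr of x's bindings in the union and in the premises.
dupl-trade : ∀ A B {X P E E' v v'} → P ≤ X → E ≤ E' → v + (E' + X) ≤ v' →
             (A + X) ∸ (B + P) + v + (E + P) ≤ (A ∸ B) + v'
dupl-trade A B {X} {P} {E} {E'} {v} {v'} P≤X E≤E' v+E'+X≤v' = begin
  (A + X) ∸ (B + P) + v + (E + P)        ≡⟨ rearrange₁ ((A + X) ∸ (B + P)) v E P ⟩
  ((A + X) ∸ (B + P) + P) + (v + E)      ≤⟨ +-mono-≤ (monus-trade A B P≤X) (+-monoʳ-≤ v E≤E') ⟩
  ((A ∸ B) + X) + (v + E')               ≡⟨ rearrange₂ (A ∸ B) X v E' ⟩
  (A ∸ B) + (v + (E' + X))               ≤⟨ +-monoʳ-≤ (A ∸ B) v+E'+X≤v' ⟩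
  (A ∸ B) + v'                           ∎
  where
  open ≤-Reasoning
  rearrange₁ : ∀ d v e p → d + v + (e + p) ≡ (d + p) + (v + e)
  rearrange₁ = solve-∀
  rearrange₂ : ∀ d x v e → (d + x) + (v + e) ≡ d + (v + (e + x))
  rearrange₂ = solve-∀

dupl-removeCtx : ∀ Ξ {Θ ρ} {Gs : List (Ctx (Ξ ++ ρ ∷ Θ))} {Γ} → IsUnion Gs Γ → NoPr (at Γ (pivot Ξ)) →
                 dupl (map (removeCtx Ξ) Gs) (removeCtx Ξ Γ) ≡ dupl Gs Γ
dupl-removeCtx Ξ {Gs = Gs} {Γ} u noPr = sym (begin
  sum (map prSize Gs) ∸ prSize Γ
    ≡⟨ cong₂ _∸_ (sum-prSize-removeCtx Ξ Gs) (prSize-removeCtx Ξ Γ) ⟩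
  (A + countPr (bindingsAt (pivot Ξ) Gs)) ∸ (B + countPr (at Γ (pivot Ξ)))
    ≡⟨ cong₂ (λ X P → (A + X) ∸ (B + P)) (NoPr⇒countPr≡0 (All.anti-mono (bindingsAt⊆at-union u (pivot Ξ)) noPr))
                                          (NoPr⇒countPr≡0 noPr) ⟩
  (A + 0) ∸ (B + 0)
    ≡⟨ cong₂ _∸_ (+-identityʳ A) (+-identityʳ B) ⟩
  A ∸ B ∎)
  where
  open ≡-Reasoning
  A B : ℕ
  A = sum (map prSize (map (removeCtx Ξ) Gs))
  B = prSize (removeCtx Ξ Γ)

-- The substitution lemma

module Substitution {σ : Sort} (W : Bind σ → ℕ) where

  weight : List (Bind σ) → ℕ
  weight l = sum (map W l)

  excess : Bind σ → ℕ
  excess b = W b ∸ isPr b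

  weight-++ : ∀ l m → weight (l ++ m) ≡ weight l + weight m
  weight-++ l m = trans (cong sum (map-++ W l m)) (sum-++ (map W l) (map W m))

  weight-++-grows : ∀ v₁ v₂ l₁ l₂ {v₁' v₂'} → v₁ + weight l₁ ≤ v₁' → v₂ + weight l₂ ≤ v₂' →
                    (v₁ + v₂) + weight (l₁ ++ l₂) ≤ v₁' + v₂'
  weight-++-grows v₁ v₂ l₁ l₂ ≤₁ ≤₂ = begin
    (v₁ + v₂) + weight (l₁ ++ l₂)         ≡⟨ cong ((v₁ + v₂) +_) (weight-++ l₁ l₂) ⟩
    (v₁ + v₂) + (weight l₁ + weight l₂)   ≡⟨ +-interchange v₁ v₂ (weight l₁) (weight l₂) ⟩
    (v₁ + weight l₁) + (v₂ + weight l₂)   ≤⟨ +-mono-≤ ≤₁ ≤₂ ⟩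
    _                                     ∎
    where open ≤-Reasoning

  Realises : ∀ {Δ} → Tm Δ σ → Bind σ → Set
  Realises {Δ} N (f , τ) = Der (emptyCtx Δ) N (W (f , τ)) τ × f ≡ flagOf (W (f , τ)) 0

  RealisesAll : ∀ {Δ} → Tm Δ σ → List (Bind σ) → Set
  RealisesAll N l = ∀ {b} → b ∈ l → Realises N b

  module _ {Δ} {N : Tm Δ σ} where

    isPr≤W : ∀ b → Realises N b → isPr b ≤ W b
    isPr≤W (pr , _) (_ , f≡) = flagOf≡pr⇒>0 _ f≡
    isPr≤W (np , _) _        = z≤n

    weight≡excess+countPr : ∀ l → RealisesAll N l → weight l ≡ sum (map excess l) + countPr l
    weight≡excess+countPr l real = begin
      sum (map W l)
        ≡⟨ cong sum (map-cong-local (All.tabulate λ b∈ → sym (m∸n+n≡m (isPr≤W _ (real b∈))))) ⟩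
      sum (map (λ b → excess b + isPr b) l)        ≡⟨ sum-map-+ excess isPr l ⟩
      sum (map excess l) + sum (map isPr l)        ≡⟨ cong (sum (map excess l) +_) (sym (countPr≡sum-isPr l)) ⟩
      sum (map excess l) + countPr l               ∎
      where open ≡-Reasoning

    countPr≤weight : ∀ l → RealisesAll N l → countPr l ≤ weight l
    countPr≤weight l real rewrite weight≡excess+countPr l real = m≤n+m _ _

    dupl-removeCtx-grows : ∀ Ξ {Θ} {Gs : List (Ctx (Ξ ++ σ ∷ Θ))} {Γ v v'} → IsUnion Gs Γ →
      RealisesAll N (at Γ (pivot Ξ)) → v + weight (bindingsAt (pivot Ξ) Gs) ≤ v' →
      dupl Gs Γ + v + weight (at Γ (pivot Ξ)) ≤ dupl (map (removeCtx Ξ) Gs) (removeCtx Ξ Γ) + v'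
    dupl-removeCtx-grows Ξ {Gs = Gs} {Γ} {v} {v'} u real v+wSₚ≤v' = begin
      dupl Gs Γ + v + weight S
        ≡⟨ cong₂ (λ d w → d + v + w) (cong₂ _∸_ (sum-prSize-removeCtx Ξ Gs) (prSize-removeCtx Ξ Γ))
                                     (weight≡excess+countPr S real) ⟩
      (A + countPr Sₚ) ∸ (B + countPr S) + v + (sum (map excess S) + countPr S)
        ≤⟨ dupl-trade A B (countPr-mono-⊆ uS S⊆Sₚ) (sum-map-⊆ excess uS S⊆Sₚ)
                      (≡.subst (λ w → v + w ≤ v') (weight≡excess+countPr Sₚ (real ∘ Sₚ⊆S)) v+wSₚ≤v') ⟩
      (A ∸ B) + v' ∎
      where
      open ≤-Reasoning
      S Sₚ : List (Bind σ)
      S  = at Γ (pivot Ξ)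
      Sₚ = bindingsAt (pivot Ξ) Gs
      A B : ℕ
      A  = sum (map prSize (map (removeCtx Ξ) Gs))
      B  = prSize (removeCtx Ξ Γ)
      uS : Unique S
      uS = at-Unique Γ (pivot Ξ)
      S⊆Sₚ : S ⊆ Sₚ
      S⊆Sₚ = at-union⊆bindingsAt u (pivot Ξ)
      Sₚ⊆S : Sₚ ⊆ S
      Sₚ⊆S = bindingsAt⊆at-union u (pivot Ξ)

  Substitutes : ∀ Ξ {Θ} → Sub (Ξ ++ σ ∷ Θ) (Ξ ++ Θ) → Tm (Ξ ++ Θ) σ → Set
  Substitutes Ξ s N = (∀ {τ} (x : (Ξ ++ _) ∋ τ) → s (punchIn Ξ x) ≡ var x) × s (pivot Ξ) ≡ N

  Substitutes-exts : ∀ Ξ {Θ ρ} {s : Sub (Ξ ++ σ ∷ Θ) (Ξ ++ Θ)} {N : Tm (Ξ ++ Θ) σ} → Substitutes Ξ s N →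
                     Substitutes (ρ ∷ Ξ) (exts s) (rename there N)
  Substitutes-exts Ξ (s-punchIn , s-pivot) =
    (λ { here → refl ; (there x) → cong (rename there) (s-punchIn x) }) , cong (rename there) s-pivot

  Realises-rename-there : ∀ {Δ ρ} {N : Tm Δ σ} {b} → Realises N b → Realises (rename (there {τ = ρ}) N) b
  Realises-rename-there (D , f≡) = weaken [] (λ _ → refl) D , f≡

  record Substituted Ξ {Θ α} (s : Sub (Ξ ++ σ ∷ Θ) (Ξ ++ Θ)) (Γ : Ctx (Ξ ++ σ ∷ Θ))
                     (K : Tm (Ξ ++ σ ∷ Θ) α) (v : ℕ) (τ : Ty α) : Set where
    constructor substituted
    field
      value      : ℕ
      derivation : Der (removeCtx Ξ Γ) (subst s K) value τ
      grows      : v + weight (at Γ (pivot Ξ)) ≤ value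
      -- needed to keep the flags of the premises of an application (see flagOf-trade)
      unchanged  : NoPr (at Γ (pivot Ξ)) → value ≡ v

  record ArgsSubstituted Ξ {Θ ρ} (s : Sub (Ξ ++ σ ∷ Θ) (Ξ ++ Θ)) (Gs : List (Ctx (Ξ ++ σ ∷ Θ)))
                         (L : Tm (Ξ ++ σ ∷ Θ) ρ) (T : List (Bind ρ)) (vs : ℕ) : Set where
    constructor substituted
    field
      value      : ℕ
      arguments  : Args (map (removeCtx Ξ) Gs) (subst s L) T value
      grows      : vs + weight (bindingsAt (pivot Ξ) Gs) ≤ value
      unchanged  : NoPr (bindingsAt (pivot Ξ) Gs) → value ≡ vs

  substitute-constant : ∀ Ξ {Θ α} {s : Sub (Ξ ++ σ ∷ Θ) (Ξ ++ Θ)} {K : Tm (Ξ ++ σ ∷ Θ) α} {v τ} →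
                        Der (emptyCtx (Ξ ++ Θ)) (subst s K) v τ → Substituted Ξ s (emptyCtx _) K v τ
  substitute-constant Ξ {Θ} {s = s} {K} {v} {τ} D =
    substituted v (≡.subst (λ Γ → Der Γ (subst s K) v τ) (sym (removeCtx-emptyCtx Ξ)) D) no-weight λ _ → refl
    where
    no-weight : v + weight (at (emptyCtx (Ξ ++ σ ∷ Θ)) (pivot Ξ)) ≤ v
    no-weight rewrite at-emptyCtx (pivot Ξ {Θ} {σ}) = ≤-reflexive (+-identityʳ v)

  substitute-var : ∀ Ξ {Θ} {s : Sub (Ξ ++ σ ∷ Θ) (Ξ ++ Θ)} {N : Tm (Ξ ++ Θ) σ} → Substitutes Ξ s N →
                   ∀ {ρ} (y : (Ξ ++ σ ∷ Θ) ∋ ρ) f τ → RealisesAll N (at (single y (f , τ)) (pivot Ξ)) →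
                   Substituted Ξ s (single y (f , τ)) (var y) 0 τ
  substitute-var Ξ {s = s} (s-punchIn , s-pivot) y f τ real with pivotView Ξ y
  ... | punched x =
    substituted 0
      (≡.subst₂ (λ Γ t → Der Γ t 0 τ) (sym (removeCtx-single-punchIn Ξ x (f , τ))) (sym (s-punchIn x))
                (dvar x f τ))
      (≤-reflexive (cong weight (at-single-punchIn-pivot Ξ x (f , τ)))) λ _ → refl
  ... | at-pivot with at-single (pivot Ξ) (f , τ)
  ...   | at≡ with real (≡.subst ((f , τ) ∈_) (sym at≡) (here refl))
  ...     | D , f≡ =
    substituted (W (f , τ))
      (≡.subst₂ (λ Γ t → Der Γ t (W (f , τ)) τ) (sym (removeCtx-single-pivot Ξ (f , τ))) (sym s-pivot) D)
      (≤-reflexive (trans (cong weight at≡) (+-identityʳ _))) unchanged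
    where
    unchanged : NoPr (at (single (pivot Ξ) (f , τ)) (pivot Ξ)) → W (f , τ) ≡ 0
    unchanged noPr with ≡.subst NoPr at≡ noPr
    ... | refl ∷ [] = flagOf≡np⇒≡0 _ f≡

  mutual
    substitute : ∀ Ξ {Θ} {s : Sub (Ξ ++ σ ∷ Θ) (Ξ ++ Θ)} {N : Tm (Ξ ++ Θ) σ} → Substitutes Ξ s N →
                 ∀ {α} {Γ : Ctx (Ξ ++ σ ∷ Θ)} {K : Tm (Ξ ++ σ ∷ Θ) α} {v τ} →
                 Der Γ K v τ → RealisesAll N (at Γ (pivot Ξ)) → Substituted Ξ s Γ K v τ
    substitute Ξ ok (da f)        real = substitute-constant Ξ (da f)
    substitute Ξ ok dc            real = substitute-constant Ξ dc
    substitute Ξ ok (db₁ f)       real = substitute-constant Ξ (db₁ f)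
    substitute Ξ ok (db₂ f)       real = substitute-constant Ξ (db₂ f)
    substitute Ξ ok (dvar y f τ)  real = substitute-var Ξ ok y f τ real
    substitute Ξ ok (dlam D)      real
      with substituted v' D' grows unchanged
             ← substitute (_ ∷ Ξ) (Substitutes-exts Ξ ok) D (Realises-rename-there ∘ real) =
      substituted v' (dlam D') grows unchanged
    substitute Ξ ok (dapp {Γ₀ = Γ₀} {Γ} {Gs} {v₀ = v₀} {vs} D args u) real
      with Sₚ⊆S ← bindingsAt⊆at-union u (pivot Ξ)
      with substituted v₀' D' grows₀ unchanged₀ ← substitute Ξ ok D (real ∘ Sₚ⊆S ∘ ∈-++⁺ˡ)
         | substituted vs' args' grows unchanged
             ← substitute-Args Ξ ok args (real ∘ Sₚ⊆S ∘ ∈-++⁺ʳ (at Γ₀ (pivot Ξ))) =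
      substituted _ (dapp D' args' (IsUnion-map (removeCtx-reindexing Ξ) u))
      (dupl-removeCtx-grows Ξ u real
        (weight-++-grows v₀ vs (at Γ₀ (pivot Ξ)) (bindingsAt (pivot Ξ) Gs) grows₀ grows))
      λ noPr → let noPrₚ = All.anti-mono Sₚ⊆S noPr in
        cong₂ _+_ (dupl-removeCtx Ξ u noPr)
                  (cong₂ _+_ (unchanged₀ (All.++⁻ˡ _ noPrₚ))
                             (unchanged (All.++⁻ʳ (at Γ₀ (pivot Ξ)) noPrₚ)))

    substitute-Args : ∀ Ξ {Θ} {s : Sub (Ξ ++ σ ∷ Θ) (Ξ ++ Θ)} {N : Tm (Ξ ++ Θ) σ} → Substitutes Ξ s N →
                      ∀ {ρ Gs} {L : Tm (Ξ ++ σ ∷ Θ) ρ} {T vs} →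
                      Args Gs L T vs → RealisesAll N (bindingsAt (pivot Ξ) Gs) → ArgsSubstituted Ξ s Gs L T vs
    substitute-Args Ξ ok [] real = substituted 0 [] z≤n λ _ → refl
    substitute-Args Ξ ok (_∷_ {Γi = Γi} {Gs} {vi = vi} {vs} {f} (D , f≡) args) real
      with substituted vi' D' growsᵢ unchangedᵢ ← substitute Ξ ok D (real ∘ ∈-++⁺ˡ)
         | substituted vs' args' grows unchanged ← substitute-Args Ξ ok args (real ∘ ∈-++⁺ʳ (at Γi (pivot Ξ))) =
      substituted _ ((D' , flag≡) ∷ args')
      (weight-++-grows vi vs (at Γi (pivot Ξ)) (bindingsAt (pivot Ξ) Gs) growsᵢ grows)
      λ noPr → cong₂ _+_ (unchangedᵢ (All.++⁻ˡ _ noPr)) (unchanged (All.++⁻ʳ (at Γi (pivot Ξ)) noPr))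
      where
      Si : List (Bind σ)
      Si = at Γi (pivot Ξ)
      flag≡ : f ≡ flagOf vi' (prSize (removeCtx Ξ Γi))
      flag≡ = trans f≡ (trans (cong (flagOf vi) (prSize-removeCtx Ξ Γi))
                (sym (flagOf-trade (prSize (removeCtx Ξ Γi)) (countPr≤weight Si (real ∘ ∈-++⁺ˡ)) growsᵢ
                       (unchangedᵢ ∘ countPr≡0⇒NoPr Si))))

-- Contracting a closed redex

argValue : ∀ {σ Gs} {L : Tm [] σ} {T vs} → Args Gs L T vs → Bind σ → ℕ
argValue []                                            b = 0
argValue (_∷_ {vi = vi} {f = f} {τi = τi} _ args) b with b ≟ᴮ (f , τi)
... | yes _ = vi
... | no  _ = argValue args b

argValue-realises : ∀ {σ Gs} {L : Tm [] σ} {T vs} (args : Args Gs L T vs) →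
                    Substitution.RealisesAll (argValue args) L T
argValue-realises (_∷_ {f = f} {τi = τi} (D , f≡) args) {b} b∈ with b ≟ᴮ (f , τi) | b∈
... | yes refl | _          = D , f≡
... | no  b≢   | here b≡    = ⊥-elim (b≢ b≡)
... | no  _    | there b∈′  = argValue-realises args b∈′

sum-argValue : ∀ {σ Gs} {L : Tm [] σ} {T vs} → Unique T → (args : Args Gs L T vs) →
               sum (map (argValue args) T) ≡ vs
sum-argValue []           []                                          = refl
sum-argValue {T = _ ∷ T} (b∉T ∷ uT) (_∷_ {vi = vi} {f = f} {τi = τi} p args) =
  cong₂ _+_ head (trans tail (sum-argValue uT args))
  where
  head : argValue (p ∷ args) (f , τi) ≡ vi
  head with (f , τi) ≟ᴮ (f , τi)
  ... | yes _ = refl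
  ... | no ≢  = ⊥-elim (≢ refl)
  tail : sum (map (argValue (p ∷ args)) T) ≡ sum (map (argValue args) T)
  tail = cong sum (map-cong-local (All.map skip b∉T))
    where
    skip : ∀ {b} → (f , τi) ≢ b → argValue (p ∷ args) b ≡ argValue args b
    skip {b} ≢ with b ≟ᴮ (f , τi)
    ... | yes refl = ⊥-elim (≢ refl)
    ... | no  _    = refl

dupl-closed : ∀ (Gs : List (Ctx [])) Γ → dupl Gs Γ ≡ 0
dupl-closed []       Γ = refl
dupl-closed (_ ∷ Gs) Γ = dupl-closed Gs Γ

contract : ∀ {σ α} {K : Tm (σ ∷ []) α} {L : Tm [] σ} {v τ} →
           Der tt (ƛ K · L) v τ → Σ ℕ λ v' → v ≤ v' × Der tt (K [ L ]) v' τ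
contract {L = L} (dapp {Γ₀ = Γ₀} {Γ} {Gs} {S = S} {v₀ = v₀} {vs} (dlam D) args u) = value , bound , derivation
  where
  open Substitution (argValue args)
  open Substituted (substitute [] {s = sub0 L} ((λ ()) , refl) D (argValue-realises args))
  bound : dupl (Γ₀ ∷ Gs) Γ + (v₀ + vs) ≤ value
  bound = ≤-trans (≤-reflexive (cong₂ _+_ (dupl-closed (Γ₀ ∷ Gs) Γ)
                                          (cong (v₀ +_) (sym (sum-argValue (at-Unique (S , tt) here) args)))))
                  grows

-- Reducing closed terms

hasRedex? : ∀ {Δ α} (M : Tm Δ α) → Dec (HasRedex M)
hasRedex? (var x) = no λ ()
hasRedex? (ƛ K) with hasRedex? K
... | yes h = yes (inƛ h)
... | no ¬h = no λ { (inƛ h) → ¬h h }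
hasRedex? (K · L) with hasRedex? K | hasRedex? L
... | yes h | _     = yes (inl h)
... | no _  | yes h = yes (inr h)
hasRedex? (ƛ K     · L) | no _  | no _   = yes redex
hasRedex? (var x   · L) | no ¬h | no ¬h' = no λ { (inl h) → ¬h h ; (inr h) → ¬h' h }
hasRedex? (K₁ · K₂ · L) | no ¬h | no ¬h' = no λ { (inl h) → ¬h h ; (inr h) → ¬h' h }
hasRedex? (`a      · L) | no ¬h | no ¬h' = no λ { (inl h) → ¬h h ; (inr h) → ¬h' h }
hasRedex? (`b      · L) | no ¬h | no ¬h' = no λ { (inl h) → ¬h h ; (inr h) → ¬h' h }
hasRedex? `a = no λ ()
hasRedex? `b = no λ ()
hasRedex? `c = no λ ()
hasRedex? `ω = no λ ()

hasRedex⇒step : ∀ {Δ α} {M : Tm Δ α} → HasRedex M → Σ (Tm Δ α) (M →β_)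
hasRedex⇒step redex   = _ , β
hasRedex⇒step (inƛ h) = _ , ξƛ (proj₂ (hasRedex⇒step h))
hasRedex⇒step (inl h) = _ , ξ₁ (proj₂ (hasRedex⇒step h))
hasRedex⇒step (inr h) = _ , ξ₂ (proj₂ (hasRedex⇒step h))

-- Closed β-normal terms are headed by a or b, so they take at most two arguments.
closed-ternary-·-hasRedex : ∀ {τ ρ σ α} (P : Tm [] (τ ⇒ ρ ⇒ σ ⇒ α)) (Q : Tm [] τ) → HasRedex (P · Q)
closed-ternary-·-hasRedex (ƛ _)     Q = redex
closed-ternary-·-hasRedex (P₁ · P₂) Q = inl (closed-ternary-·-hasRedex P₁ P₂)

IsUnion-closed : ∀ {Gs Γ} → IsUnion {[]} Gs Γ
IsUnion-closed ()

Reduct : ∀ {α} → Tm [] α → ℕ → Ty α → Set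
Reduct {α} M v τ = Σ (Tm [] α) λ N → Σ ℕ λ v' → (M →β N) × (v ≤ v') × Der tt N v' τ

reduce-discarded-argument : ∀ {σ α} {K : Tm [] (σ ⇒ α)} {L : Tm [] σ} {v₀ τ Γ₀ Γ} →
                            Der Γ₀ K v₀ (∅ˢ , τ) → IsUnion (Γ₀ ∷ []) Γ → HasRedex L →
                            Reduct (K · L) (dupl (Γ₀ ∷ []) Γ + (v₀ + 0)) τ
reduce-discarded-argument {K = K} D u h =
  let L' , L→L' = hasRedex⇒step h in K · L' , _ , ξ₂ L→L' , ≤-refl , dapp D [] u

reduce-function : ∀ {σ α} {K : Tm [] (σ ⇒ α)} {L : Tm [] σ} {S τ v₀ Gs vs Γ} →
                  Reduct K v₀ (S , τ) → Args Gs L (proj₁ S) vs → IsUnion (tt ∷ Gs) Γ →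
                  Reduct (K · L) (dupl (tt ∷ Gs) Γ + (v₀ + vs)) τ
reduce-function {L = L} {Gs = Gs} {vs} {Γ} (K' , v₀' , K→K' , v₀≤v₀' , D') args u =
  K' · L , _ , ξ₁ K→K' , +-monoʳ-≤ (dupl (tt ∷ Gs) Γ) (+-monoˡ-≤ vs v₀≤v₀') , dapp D' args u

mutual
  reduce : ∀ {v} (M : Tm [] o) → Der tt M v r → HasRedex M → Reduct M v r
  reduce (K · L) D h = reduce-· K L D h

  reduce-· : ∀ {σ α} {v} {τ : Ty α} (K : Tm [] (σ ⇒ α)) (L : Tm [] σ) →
             Der tt (K · L) v τ → HasRedex (K · L) → Reduct (K · L) v τ
  reduce-· (ƛ K) L D _ = let v' , v≤v' , D' = contract D in K [ L ] , v' , β , v≤v' , D'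
  reduce-· `a L (dapp (da _) ((DL , _) ∷ []) _) (inr h) = reduce-sole-argument da DL h
  reduce-· `b L (dapp (db₁ _) ((DL , _) ∷ []) _) (inr h) = reduce-sole-argument db₁ DL h
  reduce-· `b L (dapp (db₂ _) [] u) (inr h) = reduce-discarded-argument (db₂ _) u h
  reduce-· (P · Q) L (dapp D args u) (inl h) = reduce-function (reduce-· P Q D h) args u
  reduce-· (ƛ K · Q) L (dapp D args u) (inr _) = reduce-function (reduce-· (ƛ K) Q D redex) args u
  reduce-· (P₁ · P₂ · Q) L (dapp D args u) (inr _) =
    reduce-function (reduce-· (P₁ · P₂) Q D (inl (closed-ternary-·-hasRedex P₁ P₂))) args u
  reduce-· (`b · Q) L (dapp (dapp (db₁ f) Qargs u₀) [] u) (inr h) =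
    reduce-discarded-argument (dapp (db₁ f) Qargs u₀) u h
  reduce-· (`b · Q) L (dapp (dapp (db₂ _) [] u₀) ((DL , _) ∷ []) _) (inr h) =
    reduce-sole-argument (λ f → dapp (db₂ f) [] u₀) DL h

  -- The premise for the reduct may need the other flag, which a and b accept as well.
  reduce-sole-argument : ∀ {α} {H : Tm [] (o ⇒ α)} {vH τ} → (∀ f → Der tt H vH (⟦ f , r ⟧ˢ , τ)) →
                         ∀ {L vL} → Der tt L vL r → HasRedex L → Reduct (H · L) (vH + (vL + 0)) τ
  reduce-sole-argument {H = H} {vH} DH DL h with L' , vL' , L→L' , vL≤vL' , DL' ← reduce _ DL h =
    H · L' , _ , ξ₂ L→L' , +-monoʳ-≤ vH (+-monoˡ-≤ 0 vL≤vL') ,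
    dapp (DH (flagOf vL' 0)) ((DL' , refl) ∷ []) IsUnion-closed

lemma3 : (M : Tm [] o) (v : ℕ) → Der (emptyCtx []) M v r → ¬ IsBetaNormal M →
    Σ (Tm [] o) (λ N → Σ ℕ (λ v' → (M →β N) × (v ≤ v') × Der (emptyCtx []) N v' r))
lemma3 M v D not-normal = reduce M D (decidable-stable (hasRedex? M) not-normal)
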